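{- Let $n\ge2$, let $\pi(n)$ be a finite projective plane of order $n$, and let $N=n^2+n+1$. For any positive integers $r_1\ge r_2\ge\dots\ge r_N$, $$\mathrm{def}_c(Erd(r_1,\dots,r_N))\ge \frac{1}{10}\left(\sum_{i=n+2}^{N}r_i-9\sum_{i=1}^{n+1}r_i+9\right).$$
   Context: All graphs are finite, simple and undirected. A finite projective plane $\pi(n)$ of order $n\ge2$ has $N=n^2+n+1$ points and $N$ lines (each line a set of points) such that any two points lie on a unique common line, any two lines share a unique point, every point lies on $n+1$ lines, and every line contains $n+1$ points. Identify the points with $\{1,\dots,N\}$ and enumerate the lines as $l_1,\dots,l_N$. For positive integers $r_1,\dots,r_N$, the graph $Erd(r_1,\dots,r_N)$ has vertex set $\{u\}\cup\{1,\dots,N\}\cup\{v^{(l_i)}_1,\dots,v^{(l_i)}_{r_i}:1\le i\le N\}$ and edges $uv^{(l_i)}_j$ for all $1\le i\le N$, $1\le j\le r_i$, together with $v^{(l_i)}_jk$ for all $1\le i\le N$, $1\le j\le r_i$ and every point $k\in l_i$. A set $A\subseteq\{1,\dots,t\}$ is a cyclic interval modulo $t$ if $A$ or $\{1,\dots,t\}\setminus A$ is an interval of integers; a cyclic interval $t$-coloring is a proper edge coloring with colors $1,\dots,t$ in which the set of colors at every vertex is a cyclic interval modulo $t$. The cyclic deficiency $\mathrm{def}_c(G)$ is the minimum number of pendant edges whose attachment to $G$ yields a graph admitting a cyclic interval coloring. -}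

module Defs where

open import Data.Nat using (ℕ; zero; suc; _+_; _*_; _≤_; _<ᵇ_)
open import Data.Bool using (Bool; true; false; T; if_then_else_)
open import Data.Fin using (Fin; toℕ)
open import Data.Vec using (tabulate; sum)
open import Data.Sum using (_⊎_; inj₁; inj₂)
open import Data.Product using (Σ; _×_; _,_; ∃)
open import Data.Empty using (⊥)
open import Relation.Nullary using (¬_)
open import Relation.Binary.PropositionalEquality using (_≡_; _≢_)

sumWhere : ∀ {m} → (Fin m → Bool) → (Fin m → ℕ) → ℕ
sumWhere P f = sum (tabulate (λ i → if P i then f i else 0))

count : ∀ {m} → (Fin m → Bool) → ℕ
count P = sumWhere P (λ _ → 1)

-- Finite projective planes of order n.
-- Points and lines are both indexed by Fin N, N = n² + n + 1;
-- incident l p = true  iff  point p lies on line l.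

N : ℕ → ℕ
N n = n * n + n + 1

record ProjectivePlane (n : ℕ) : Set where
  field
    incident   : Fin (N n) → Fin (N n) → Bool
    two-points : ∀ p q → p ≢ q →
                 Σ (Fin (N n)) λ l → T (incident l p) × T (incident l q) ×
                   (∀ l′ → T (incident l′ p) → T (incident l′ q) → l′ ≡ l)
    two-lines  : ∀ l m → l ≢ m →
                 Σ (Fin (N n)) λ p → T (incident l p) × T (incident m p) ×
                   (∀ p′ → T (incident l p′) → T (incident m p′) → p′ ≡ p)
    point-deg  : ∀ p → count (λ l → incident l p) ≡ suc n
    line-size  : ∀ l → count (λ p → incident l p) ≡ suc n

record Graph : Set₁ where
  field
    V     : Set
    Adj   : V → V → Set
    sym   : ∀ {x y} → Adj x y → Adj y x
    irr   : ∀ {x} → ¬ Adj x x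

-- A ∩ {1..t} is an interval of integers {a,…,b} (empty allowed, a > b)
IsInterval : ℕ → (ℕ → Set) → Set
IsInterval t A = Σ ℕ λ a → Σ ℕ λ b → ∀ m → 1 ≤ m → m ≤ t →
  (A m → a ≤ m × m ≤ b) × (a ≤ m × m ≤ b → A m)

CyclicInterval : ℕ → (ℕ → Set) → Set
CyclicInterval t A = IsInterval t A ⊎ IsInterval t (λ m → ¬ A m)

module _ (G : Graph) where
  open Graph G

  -- colour of edge xy is c x y (only meaningful when Adj x y)
  record CyclicIntervalColoring (t : ℕ) : Set where
    field
      c         : V → V → ℕ
      symmetric : ∀ {x y} → Adj x y → c x y ≡ c y x
      range     : ∀ {x y} → Adj x y → 1 ≤ c x y × c x y ≤ t
      proper    : ∀ {x y z} → Adj x y → Adj x z → c x y ≡ c x z → y ≡ z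
      cyclic    : ∀ x → CyclicInterval t (λ m → Σ V λ y → Adj x y × c x y ≡ m)

  HasCyclicIntervalColoring : Set
  HasCyclicIntervalColoring = Σ ℕ λ t → CyclicIntervalColoring t

data PAdj (G : Graph) {k : ℕ} (f : Fin k → Graph.V G) :
          Graph.V G ⊎ Fin k → Graph.V G ⊎ Fin k → Set where
  old  : ∀ {x y} → Graph.Adj G x y → PAdj G f (inj₁ x) (inj₁ y)
  pend : ∀ {x j} → f j ≡ x → PAdj G f (inj₁ x) (inj₂ j)
  pend′ : ∀ {x j} → f j ≡ x → PAdj G f (inj₂ j) (inj₁ x)

attachPendant : (G : Graph) (k : ℕ) → (Fin k → Graph.V G) → Graph
attachPendant G k f = record
  { V = Graph.V G ⊎ Fin k
  ; Adj = PAdj G f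
  ; sym = λ { (old a) → old (Graph.sym G a) ; (pend e) → pend′ e ; (pend′ e) → pend e }
  ; irr = λ { (old a) → Graph.irr G a }
  }

-- "def_c(G) ≥ d" in the sense: every attachment of k pendant edges that
-- admits a cyclic interval colouring has k ≥ d (d given via 10·k ≥ …)

module _ {n : ℕ} (P : ProjectivePlane n) (r : Fin (N n) → ℕ) where
  open ProjectivePlane P

  data ErdV : Set where
    u  : ErdV
    pt : Fin (N n) → ErdV
    vx : (i : Fin (N n)) → Fin (r i) → ErdV

  data ErdAdj : ErdV → ErdV → Set where
    u-v  : ∀ {i j} → ErdAdj u (vx i j)
    v-u  : ∀ {i j} → ErdAdj (vx i j) u
    v-p  : ∀ {i j k} → T (incident i k) → ErdAdj (vx i j) (pt k)
    p-v  : ∀ {i j k} → T (incident i k) → ErdAdj (pt k) (vx i j)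

  Erd : Graph
  Erd = record
    { V = ErdV
    ; Adj = ErdAdj
    ; sym = λ { u-v → v-u ; v-u → u-v ; (v-p e) → p-v e ; (p-v e) → v-p e }
    ; irr = λ ()
    }

module Submission where

-- In a cyclic interval t-colouring, the colours at a vertex with at most D + 1 neighbours lie on
-- an arc of the colour cycle, so any two of them are at most D apart cyclically. Any two lines of
-- the plane meet in a point p, so every edge u vx(i,j) is linked to a fixed edge u vx(i₀,j₀) by
-- the path u – vx(i₀,j₀) – p – vx(i,j) – u. Each vertex carries at most k pendant edges, a point
-- lies on n + 1 lines, and r is non-increasing, so the distances at the three inner vertices add
-- up to at most Dt = 2(n + 1 + k) + (r₁ + … + r_{n+1} + k). The ∑ r colours at u are distinct
-- and lie within Dt of one of them, hence ∑ r ≤ 2 Dt + 1, which rearranges to the claim for n ≥ 2.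

open import Defs
open import Data.Bool using (Bool; true; false; T; if_then_else_; not; _∧_)
open import Data.Bool.Properties using (∧-comm; T-not-≡)
open import Data.Empty using (⊥-elim)
open import Data.Fin as Fin using (Fin; toℕ; fromℕ<; _↑ˡ_; _↑ʳ_; splitAt)
import Data.Fin.Properties as Fin
open import Data.Integer as ℤ using (ℤ; +_; -[1+_]; +[1+_]; ∣_∣)
import Data.Integer.Properties as ℤₚ
import Data.Integer.Tactic.RingSolver as ℤ-Solver
open import Data.List as List using (List; []; _∷_; _++_; [_]; length; lookup)
open import Data.List.Properties using (length-++; length-tabulate)
open import Data.List.Membership.Propositional using (_∈_)
open import Data.List.Membership.Propositional.Properties using (∈-++⁺ˡ; ∈-++⁺ʳ; ∈-tabulate⁺)
open import Data.List.Relation.Unary.Any using (here; there; index)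
open import Data.List.Relation.Unary.Any.Properties using (lookup-index)
open import Data.Nat
open import Data.Nat.Properties
import Data.Nat.Tactic.RingSolver as ℕ-Solver
open import Algebra.Properties.Semiring.Sum +-*-semiring using (sum; sum-cong-≗; ∑-distrib-+; *-distribʳ-sum)
open import Data.Product using (Σ; _×_; _,_; proj₁; proj₂; map)
open import Data.Sum using (_⊎_; inj₁; inj₂)
import Data.Vec as Vec
import Data.Vec.Properties as Vec
open import Function using (_∘_; id; Equivalence)
open import Function.Definitions using (Injective)
open import Relation.Nullary using (¬_; yes; no; contradiction)
open import Relation.Nullary.Decidable using (decidable-stable)
open import Relation.Nullary.Negation using (¬¬-map)
open import Relation.Binary.PropositionalEquality hiding ([_])

sum-tabulate : ∀ {m} (f : Fin m → ℕ) → Vec.sum (Vec.tabulate f) ≡ sum f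
sum-tabulate {zero}  f = refl
sum-tabulate {suc m} f = cong (λ s → f Fin.zero + s) (sum-tabulate (f ∘ Fin.suc))

sumWhere≡sum : ∀ {m} (P : Fin m → Bool) (f : Fin m → ℕ) → sumWhere P f ≡ sum (λ i → if P i then f i else 0)
sumWhere≡sum P f = sum-tabulate (λ i → if P i then f i else 0)

sum-mono-≤ : ∀ {m} {f g : Fin m → ℕ} → (∀ i → f i ≤ g i) → sum f ≤ sum g
sum-mono-≤ {zero}  f≤g = z≤n
sum-mono-≤ {suc m} f≤g = +-mono-≤ (f≤g Fin.zero) (sum-mono-≤ (f≤g ∘ Fin.suc))

sumWhere-cong : ∀ {m} {P Q : Fin m → Bool} (f : Fin m → ℕ) → (∀ i → P i ≡ Q i) →
                sumWhere P f ≡ sumWhere Q f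
sumWhere-cong f P≡Q = cong Vec.sum (Vec.tabulate-cong (λ i → cong (λ b → if b then f i else 0) (P≡Q i)))

if-∧-split : ∀ a b x → (if a then x else 0) ≡ (if a ∧ b then x else 0) + (if a ∧ not b then x else 0)
if-∧-split false _     _ = refl
if-∧-split true  true  x = sym (+-identityʳ x)
if-∧-split true  false x = refl

sumWhere-split : ∀ {m} (P Q : Fin m → Bool) (f : Fin m → ℕ) →
                 sumWhere P f ≡ sumWhere (λ i → P i ∧ Q i) f + sumWhere (λ i → P i ∧ not (Q i)) f
sumWhere-split P Q f = begin
  sumWhere P f                                 ≡⟨ sumWhere≡sum P f ⟩
  sum (λ i → if P i then f i else 0)           ≡⟨ sum-cong-≗ (λ i → if-∧-split (P i) (Q i) (f i)) ⟩
  sum (λ i → both i + only i)                  ≡⟨ ∑-distrib-+ both only ⟩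
  sum both + sum only                          ≡⟨ cong₂ _+_ (sumWhere≡sum P∧Q f) (sumWhere≡sum P∖Q f) ⟨
  sumWhere P∧Q f + sumWhere P∖Q f              ∎
  where
  open ≡-Reasoning
  P∧Q P∖Q : Fin _ → Bool
  P∧Q i = P i ∧ Q i
  P∖Q i = P i ∧ not (Q i)
  both only : Fin _ → ℕ
  both i = if P∧Q i then f i else 0
  only i = if P∖Q i then f i else 0

sum≡sumWhere+sumWhere-not : ∀ {m} (P : Fin m → Bool) (f : Fin m → ℕ) →
                            sum f ≡ sumWhere P f + sumWhere (λ i → not (P i)) f
sum≡sumWhere+sumWhere-not P f = trans (sym (sum-tabulate f)) (sumWhere-split (λ _ → true) P f)

sumWhere≤count*bound : ∀ {m} (P : Fin m → Bool) (f : Fin m → ℕ) c →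
                       (∀ i → T (P i) → f i ≤ c) → sumWhere P f ≤ count P * c
sumWhere≤count*bound P f c f≤c = begin
  sumWhere P f                              ≡⟨ sumWhere≡sum P f ⟩
  sum (λ i → if P i then f i else 0)        ≤⟨ sum-mono-≤ pointwise ⟩
  sum (λ i → (if P i then 1 else 0) * c)    ≡⟨ *-distribʳ-sum c (λ i → if P i then 1 else 0) ⟨
  sum (λ i → if P i then 1 else 0) * c      ≡⟨ cong (_* c) (sumWhere≡sum P (λ _ → 1)) ⟨
  count P * c                               ∎
  where
  open ≤-Reasoning
  pointwise : ∀ i → (if P i then f i else 0) ≤ (if P i then 1 else 0) * c
  pointwise i with P i | f≤c i
  ... | true  | h = ≤-trans (h _) (m≤m+n c 0)
  ... | false | _ = z≤n

count*bound≤sumWhere : ∀ {m} (P : Fin m → Bool) (f : Fin m → ℕ) c →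
                       (∀ i → T (P i) → c ≤ f i) → count P * c ≤ sumWhere P f
count*bound≤sumWhere P f c c≤f = begin
  count P * c                               ≡⟨ cong (_* c) (sumWhere≡sum P (λ _ → 1)) ⟩
  sum (λ i → if P i then 1 else 0) * c      ≡⟨ *-distribʳ-sum c (λ i → if P i then 1 else 0) ⟩
  sum (λ i → (if P i then 1 else 0) * c)    ≤⟨ sum-mono-≤ pointwise ⟩
  sum (λ i → if P i then f i else 0)        ≡⟨ sumWhere≡sum P f ⟨
  sumWhere P f                              ∎
  where
  open ≤-Reasoning
  pointwise : ∀ i → (if P i then 1 else 0) * c ≤ (if P i then f i else 0)
  pointwise i with P i | c≤f i
  ... | true  | h = ≤-trans (≤-reflexive (+-identityʳ c)) (h _)
  ... | false | _ = z≤n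

-- Exchanging the indices of A outside F for those of F outside A (equally many)
-- can only increase the sum, as the threshold c separates the two groups.
sumWhere-≤-threshold : ∀ {m} (A F : Fin m → Bool) (f : Fin m → ℕ) c → count A ≡ count F →
                       (∀ i → T (F i) → c ≤ f i) → (∀ i → T (not (F i)) → f i ≤ c) →
                       sumWhere A f ≤ sumWhere F f
sumWhere-≤-threshold A F f c |A|≡|F| large small = begin
  sumWhere A f                                  ≡⟨ sumWhere-split A F f ⟩
  sumWhere A∧F f + sumWhere A∖F f               ≤⟨ +-monoʳ-≤ _ (sumWhere≤count*bound A∖F f c small′) ⟩
  sumWhere A∧F f + count A∖F * c
    ≡⟨ cong₂ (λ x y → x + y * c) (sumWhere-cong f ∧-swap) |A∖F|≡|F∖A| ⟩
  sumWhere F∧A f + count F∖A * c                ≤⟨ +-monoʳ-≤ _ (count*bound≤sumWhere F∖A f c large′) ⟩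
  sumWhere F∧A f + sumWhere F∖A f               ≡⟨ sumWhere-split F A f ⟨
  sumWhere F f                                  ∎
  where
  open ≤-Reasoning
  A∧F A∖F F∧A F∖A : Fin _ → Bool
  A∧F i = A i ∧ F i
  A∖F i = A i ∧ not (F i)
  F∧A i = F i ∧ A i
  F∖A i = F i ∧ not (A i)

  ∧-swap : ∀ i → A∧F i ≡ F∧A i
  ∧-swap i = ∧-comm (A i) (F i)

  |A∖F|≡|F∖A| : count A∖F ≡ count F∖A
  |A∖F|≡|F∖A| = +-cancelˡ-≡ (count A∧F) _ _ (begin-equality
    count A∧F + count A∖F   ≡⟨ sumWhere-split A F _ ⟨
    count A                 ≡⟨ |A|≡|F| ⟩
    count F                 ≡⟨ sumWhere-split F A _ ⟩
    count F∧A + count F∖A   ≡⟨ cong (_+ count F∖A) (sumWhere-cong _ ∧-swap) ⟨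
    count A∧F + count F∖A   ∎)

  small′ : ∀ i → T (A∖F i) → f i ≤ c
  small′ i h with A i | F i | small i
  ... | true | false | f≤c = f≤c _

  large′ : ∀ i → T (F∖A i) → c ≤ f i
  large′ i h with F i | A i | large i
  ... | true | false | c≤f = c≤f _

count-initial : ∀ {M} m → m ≤ M → count {M} (λ i → toℕ i <ᵇ m) ≡ m
count-initial {zero}  zero    _         = refl
count-initial {suc M} zero    _         = count-initial {M} zero z≤n
count-initial {suc M} (suc m) (s≤s m≤M) = cong suc (count-initial m m≤M)

sumWhere-≤-initial : ∀ {M} (r : Fin M → ℕ) → (∀ i j → toℕ i ≤ toℕ j → r j ≤ r i) →
                     (A : Fin M → Bool) {m : ℕ} → m < M → count A ≡ m →
                     sumWhere A r ≤ sumWhere (λ i → toℕ i <ᵇ m) r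
sumWhere-≤-initial {M} r antitone A {m} m<M |A|≡m =
  sumWhere-≤-threshold A initial r (r threshold) (trans |A|≡m (sym (count-initial m (<⇒≤ m<M)))) large small
  where
  initial : Fin M → Bool
  initial i = toℕ i <ᵇ m
  threshold : Fin M
  threshold = fromℕ< m<M

  large : ∀ i → T (initial i) → r threshold ≤ r i
  large i i<m = antitone i threshold
    (≤-trans (<⇒≤ (<ᵇ⇒< (toℕ i) m i<m)) (≤-reflexive (sym (Fin.toℕ-fromℕ< m<M))))

  small : ∀ i → T (not (initial i)) → r i ≤ r threshold
  small i i≮m = antitone threshold i (≤-trans (≤-reflexive (Fin.toℕ-fromℕ< m<M))
    (≮⇒≥ (λ i<m → subst T (Equivalence.to T-not-≡ i≮m) (<⇒<ᵇ i<m))))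

count≡suc⇒nonempty : ∀ {m} (P : Fin m → Bool) {k} → count P ≡ suc k → Σ (Fin m) (T ∘ P)
count≡suc⇒nonempty {zero} P ()
count≡suc⇒nonempty {suc m} P |P|≡1+k with P Fin.zero in P0
... | true  = Fin.zero , subst T (sym P0) _
... | false with count≡suc⇒nonempty (P ∘ Fin.suc) |P|≡1+k
...   | i , Pi = Fin.suc i , Pi

record Within (t D a b : ℕ) : Set where
  constructor within
  field
    shift   : ℤ
    winding : ℤ
    bounded : ∣ shift ∣ ≤ D
    reaches : + b ≡ + a ℤ.+ shift ℤ.+ winding ℤ.* + t

within-sym : ∀ {t D a b} → Within t D a b → Within t D b a
within-sym {t} {a = a} (within z q small b≡) =
  within (ℤ.- z) (ℤ.- q) (subst (_≤ _) (sym (ℤₚ.∣-i∣≡∣i∣ z)) small)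
         (trans (undo (+ a) z q (+ t)) (cong (λ x → x ℤ.+ ℤ.- z ℤ.+ ℤ.- q ℤ.* + t) (sym b≡)))
  where
  undo : ∀ A Z Q T → A ≡ A ℤ.+ Z ℤ.+ Q ℤ.* T ℤ.+ ℤ.- Z ℤ.+ ℤ.- Q ℤ.* T
  undo = ℤ-Solver.solve-∀

within-trans : ∀ {t D E a b c} → Within t D a b → Within t E b c → Within t (D + E) a c
within-trans {t} {a = a} (within z q small b≡) (within z′ q′ small′ c≡) =
  within (z ℤ.+ z′) (q ℤ.+ q′) (≤-trans (ℤₚ.∣i+j∣≤∣i∣+∣j∣ z z′) (+-mono-≤ small small′))
         (trans c≡ (trans (cong (λ x → x ℤ.+ z′ ℤ.+ q′ ℤ.* + t) b≡) (regroup (+ a) z z′ q q′ (+ t))))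
  where
  regroup : ∀ A Z Z′ Q Q′ T →
            A ℤ.+ Z ℤ.+ Q ℤ.* T ℤ.+ Z′ ℤ.+ Q′ ℤ.* T ≡ A ℤ.+ (Z ℤ.+ Z′) ℤ.+ (Q ℤ.+ Q′) ℤ.* T
  regroup = ℤ-Solver.solve-∀

private
  pos-+-pos* : ∀ a m t → + a ℤ.+ +[1+ m ] ℤ.* + t ≡ + (a + suc m * t)
  pos-+-pos* a m t = trans (cong (λ x → + a ℤ.+ x) (sym (ℤₚ.pos-* (suc m) t))) (sym (ℤₚ.pos-+ a (suc m * t)))

  beyond : ∀ {a t} m → 1 ≤ a → t < a + suc m * t
  beyond {a} {t} m 1≤a = +-mono-≤ 1≤a (m≤m+n t (m * t))

≡-mod-range : ∀ {t x y} (d : ℤ) → 1 ≤ x → x ≤ t → 1 ≤ y → y ≤ t →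
              + y ≡ + x ℤ.+ d ℤ.* + t → y ≡ x
≡-mod-range {t} {x} (+ zero) _ _ _ _ y≡ = ℤₚ.+-injective (trans y≡ (ℤₚ.+-identityʳ (+ x)))
≡-mod-range {t} {x} {y} +[1+ m ] 1≤x _ _ y≤t y≡ =
  contradiction y≤t (<⇒≱ (subst (t <_) (sym (ℤₚ.+-injective (trans y≡ (pos-+-pos* x m t)))) (beyond m 1≤x)))
≡-mod-range {t} {x} {y} -[1+ m ] _ x≤t 1≤y _ y≡ =
  contradiction x≤t (<⇒≱ (subst (t <_) (sym (ℤₚ.+-injective (trans x≡ (pos-+-pos* y m t)))) (beyond m 1≤y)))
  where
  x≡ : + x ≡ + y ℤ.+ +[1+ m ] ℤ.* + t
  x≡ = trans (rearrange (+ x) +[1+ m ] (+ t)) (cong (ℤ._+ +[1+ m ] ℤ.* + t) (sym y≡))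
    where
    rearrange : ∀ X M T → X ≡ X ℤ.+ ℤ.- M ℤ.* T ℤ.+ M ℤ.* T
    rearrange = ℤ-Solver.solve-∀

same-shift⇒≡ : ∀ {t D E a b b′} (w : Within t D a b) (w′ : Within t E a b′) →
               Within.shift w ≡ Within.shift w′ →
               1 ≤ b → b ≤ t → 1 ≤ b′ → b′ ≤ t → b′ ≡ b
same-shift⇒≡ {t} {a = a} {b} (within z q _ b≡) (within .z q′ _ b′≡) refl 1≤b b≤t 1≤b′ b′≤t =
  ≡-mod-range (q′ ℤ.- q) 1≤b b≤t 1≤b′ b′≤t
    (trans b′≡ (trans (cong (λ x → x ℤ.+ z ℤ.+ q′ ℤ.* + t) a≡) (cancel (+ b) z q q′ (+ t))))
  where
  a≡ : + a ≡ + b ℤ.- z ℤ.- q ℤ.* + t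
  a≡ = trans (solve-back (+ a) z q (+ t)) (cong (λ x → x ℤ.- z ℤ.- q ℤ.* + t) (sym b≡))
    where
    solve-back : ∀ A Z Q T → A ≡ A ℤ.+ Z ℤ.+ Q ℤ.* T ℤ.- Z ℤ.- Q ℤ.* T
    solve-back = ℤ-Solver.solve-∀
  cancel : ∀ B Z Q Q′ T → B ℤ.- Z ℤ.- Q ℤ.* T ℤ.+ Z ℤ.+ Q′ ℤ.* T ≡ B ℤ.+ (Q′ ℤ.- Q) ℤ.* T
  cancel = ℤ-Solver.solve-∀

shiftCode : ∀ D (z : ℤ) → ∣ z ∣ ≤ D → Fin (suc D + D)
shiftCode D (+ m)    m≤D = fromℕ< (s≤s m≤D) ↑ˡ D
shiftCode D -[1+ m ] m<D = suc D ↑ʳ fromℕ< m<D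

↑ˡ≢↑ʳ : ∀ {m n} (i : Fin m) (j : Fin n) → i ↑ˡ n ≢ m ↑ʳ j
↑ˡ≢↑ʳ Fin.zero    j ()
↑ˡ≢↑ʳ (Fin.suc i) j i≡j = ↑ˡ≢↑ʳ i j (Fin.suc-injective i≡j)

shiftCode-injective : ∀ D {z z′} (h : ∣ z ∣ ≤ D) (h′ : ∣ z′ ∣ ≤ D) →
                      shiftCode D z h ≡ shiftCode D z′ h′ → z ≡ z′
shiftCode-injective D {+ m} {+ m′} _ _ eq =
  cong +_ (Fin.fromℕ<-injective m m′ _ _ (Fin.↑ˡ-injective D _ _ eq))
shiftCode-injective D { -[1+ m ]} { -[1+ m′ ]} _ _ eq =
  cong -[1+_] (Fin.fromℕ<-injective m m′ _ _ (Fin.↑ʳ-injective (suc D) _ _ eq))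
shiftCode-injective D {+ m} { -[1+ m′ ]} _ _ eq = contradiction eq (↑ˡ≢↑ʳ _ _)
shiftCode-injective D { -[1+ m ]} {+ m′} _ _ eq = contradiction (sym eq) (↑ˡ≢↑ʳ _ _)

toΣ : ∀ {m} (r : Fin m → ℕ) → Fin (sum r) → Σ (Fin m) (Fin ∘ r)
toΣ {suc m} r e with splitAt (r Fin.zero) e
... | inj₁ j = Fin.zero , j
... | inj₂ e′ = map Fin.suc id (toΣ (r ∘ Fin.suc) e′)

fromΣ : ∀ {m} (r : Fin m → ℕ) → Σ (Fin m) (Fin ∘ r) → Fin (sum r)
fromΣ {suc m} r (Fin.zero  , j) = j ↑ˡ sum (r ∘ Fin.suc)
fromΣ {suc m} r (Fin.suc i , j) = r Fin.zero ↑ʳ fromΣ (r ∘ Fin.suc) (i , j)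

fromΣ-toΣ : ∀ {m} (r : Fin m → ℕ) e → fromΣ r (toΣ r e) ≡ e
fromΣ-toΣ {suc m} r e with splitAt (r Fin.zero) e in split≡
... | inj₁ j  = Fin.splitAt⁻¹-↑ˡ split≡
... | inj₂ e′ = trans (cong (r Fin.zero ↑ʳ_) (fromΣ-toΣ (r ∘ Fin.suc) e′)) (Fin.splitAt⁻¹-↑ʳ split≡)

toΣ-injective : ∀ {m} (r : Fin m → ℕ) {e e′} → toΣ r e ≡ toΣ r e′ → e ≡ e′
toΣ-injective r {e} {e′} eq = trans (sym (fromΣ-toΣ r e)) (trans (cong (fromΣ r) eq) (fromΣ-toΣ r e′))

¬¬-∀-Fin : ∀ {w} {B : Fin w → Set} → (∀ i → ¬ ¬ B i) → ¬ ¬ (∀ i → B i)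
¬¬-∀-Fin {zero}  ¬¬B ¬∀B = ¬∀B (λ ())
¬¬-∀-Fin {suc w} ¬¬B ¬∀B = ¬¬B Fin.zero λ B₀ → ¬¬-∀-Fin (¬¬B ∘ Fin.suc) λ B₊ →
  ¬∀B λ { Fin.zero → B₀ ; (Fin.suc i) → B₊ i }

-- Only ¬ ¬ A: lying outside an interval that is the complement of A merely refutes ¬ A.
AllIn : (ℕ → Set) → ℕ → ℕ → Set
AllIn A lo hi = ∀ m → lo ≤ m → m ≤ hi → ¬ ¬ A m

cyclicInterval-arc : ∀ {t} {A : ℕ → Set} {m₁ m₂} → CyclicInterval t A →
                     1 ≤ m₁ → m₁ ≤ m₂ → m₂ ≤ t → A m₁ → A m₂ →
                     AllIn A m₁ m₂ ⊎ (m₁ < m₂ × AllIn A 1 m₁ × AllIn A m₂ t)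
cyclicInterval-arc {m₁ = m₁} {m₂} (inj₁ (a , b , A≡[a,b])) 1≤m₁ m₁≤m₂ m₂≤t Am₁ Am₂ =
  inj₁ λ m m₁≤m m≤m₂ ¬Am → ¬Am (proj₂ (A≡[a,b] m (≤-trans 1≤m₁ m₁≤m) (≤-trans m≤m₂ m₂≤t))
    (≤-trans a≤m₁ m₁≤m , ≤-trans m≤m₂ m₂≤b))
  where
  a≤m₁ = proj₁ (proj₁ (A≡[a,b] m₁ 1≤m₁ (≤-trans m₁≤m₂ m₂≤t)) Am₁)
  m₂≤b = proj₂ (proj₁ (A≡[a,b] m₂ (≤-trans 1≤m₁ m₁≤m₂) m₂≤t) Am₂)
cyclicInterval-arc {t} {A} {m₁} {m₂} (inj₂ (a , b , ∁A≡[a,b])) 1≤m₁ m₁≤m₂ m₂≤t Am₁ Am₂ = arc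
  where
  outside : ∀ {m} → 1 ≤ m → m ≤ t → ¬ (a ≤ m × m ≤ b) → ¬ ¬ A m
  outside 1≤m m≤t m∉[a,b] ¬Am = m∉[a,b] (proj₁ (∁A≡[a,b] _ 1≤m m≤t) ¬Am)

  inside : ∀ {m} → 1 ≤ m → m ≤ t → A m → ¬ (a ≤ m × m ≤ b)
  inside 1≤m m≤t Am m∈[a,b] = proj₂ (∁A≡[a,b] _ 1≤m m≤t) m∈[a,b] Am

  arc : AllIn A m₁ m₂ ⊎ (m₁ < m₂ × AllIn A 1 m₁ × AllIn A m₂ t)
  arc with b <? m₁ | a ≤? m₁ | m₂ <? a | b <? m₂
  ... | yes b<m₁ | _ | _ | _ = inj₁ λ m m₁≤m m≤m₂ →
    outside (≤-trans 1≤m₁ m₁≤m) (≤-trans m≤m₂ m₂≤t)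
            λ (_ , m≤b) → <⇒≱ b<m₁ (≤-trans m₁≤m m≤b)
  ... | no b≮m₁ | yes a≤m₁ | _ | _ =
    ⊥-elim (inside 1≤m₁ (≤-trans m₁≤m₂ m₂≤t) Am₁ (a≤m₁ , ≮⇒≥ b≮m₁))
  ... | no _ | no _ | yes m₂<a | _ = inj₁ λ m m₁≤m m≤m₂ →
    outside (≤-trans 1≤m₁ m₁≤m) (≤-trans m≤m₂ m₂≤t)
            λ (a≤m , _) → <⇒≱ m₂<a (≤-trans a≤m m≤m₂)
  ... | no _ | no _ | no m₂≮a | no b≮m₂ =
    ⊥-elim (inside (≤-trans 1≤m₁ m₁≤m₂) m₂≤t Am₂ (≮⇒≥ m₂≮a , ≮⇒≥ b≮m₂))
  ... | no _ | no a≰m₁ | no m₂≮a | yes b<m₂ = inj₂ (<-≤-trans (≰⇒> a≰m₁) (≮⇒≥ m₂≮a) ,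
    (λ m 1≤m m≤m₁ → outside 1≤m (≤-trans m≤m₁ (≤-trans m₁≤m₂ m₂≤t))
                      λ (a≤m , _) → a≰m₁ (≤-trans a≤m m≤m₁)) ,
    (λ m m₂≤m m≤t → outside (≤-trans 1≤m₁ (≤-trans m₁≤m₂ m₂≤m)) m≤t
                      λ (_ , m≤b) → <⇒≱ b<m₂ (≤-trans m₂≤m m≤b)))

module _ (G : Graph) {t : ℕ} (col : CyclicIntervalColoring G t) where
  open Graph G using (V; Adj)
  open CyclicIntervalColoring col using (c; range; cyclic)

  HasColour : V → ℕ → Set
  HasColour x m = Σ V λ y → Adj x y × c x y ≡ m

  module _ (x : V) (L : List V) (complete : ∀ {y} → Adj x y → y ∈ L) where

    distinct-colours-≤-length : ∀ {w} (κ : Fin w → ℕ) → Injective _≡_ _≡_ κ →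
                                (∀ i → ¬ ¬ HasColour x (κ i)) → w ≤ length L
    distinct-colours-≤-length {w} κ κ-injective coloured =
      decidable-stable (w ≤? length L)
        (¬¬-map (λ has → Fin.injective⇒≤ (position-injective has)) (¬¬-∀-Fin coloured))
      where
      listed : (has : ∀ i → HasColour x (κ i)) → ∀ i → proj₁ (has i) ∈ L
      listed has i = complete (proj₁ (proj₂ (has i)))

      position : (∀ i → HasColour x (κ i)) → Fin w → Fin (length L)
      position has = index ∘ listed has

      position-injective : ∀ has → Injective _≡_ _≡_ (position has)
      position-injective has {i} {j} same = κ-injective (begin
        κ i                    ≡⟨ proj₂ (proj₂ (has i)) ⟨
        c x (proj₁ (has i))    ≡⟨ cong (c x) neighbour≡ ⟩
        c x (proj₁ (has j))    ≡⟨ proj₂ (proj₂ (has j)) ⟩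
        κ j                    ∎)
        where
        open ≡-Reasoning
        neighbour≡ : proj₁ (has i) ≡ proj₁ (has j)
        neighbour≡ = trans (lookup-index (listed has i))
                           (trans (cong (lookup L) same) (sym (lookup-index (listed has j))))

    module _ {D : ℕ} (short : length L ≤ suc D) where

      arc-within : ∀ {m₁ m₂} → m₁ ≤ m₂ → AllIn (HasColour x) m₁ m₂ → Within t D m₁ m₂
      arc-within {m₁} {m₂} m₁≤m₂ coloured =
        within (+ (m₂ ∸ m₁)) (+ 0) (≤-pred (≤-trans counted short))
               (trans (cong +_ (sym (m+[n∸m]≡n m₁≤m₂)))
                      (trans (ℤₚ.pos-+ m₁ (m₂ ∸ m₁)) (no-winding (+ m₁) (+ (m₂ ∸ m₁)) (+ t))))
        where
        κ : Fin (suc (m₂ ∸ m₁)) → ℕ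
        κ i = m₁ + toℕ i
        counted : suc (m₂ ∸ m₁) ≤ length L
        counted = distinct-colours-≤-length κ (Fin.toℕ-injective ∘ +-cancelˡ-≡ m₁ _ _) λ i →
          coloured (κ i) (m≤m+n m₁ (toℕ i))
                   (≤-trans (+-monoʳ-≤ m₁ (≤-pred (Fin.toℕ<n i))) (≤-reflexive (m+[n∸m]≡n m₁≤m₂)))
        no-winding : ∀ A B T → A ℤ.+ B ≡ A ℤ.+ B ℤ.+ + 0 ℤ.* T
        no-winding = ℤ-Solver.solve-∀

      wrap-within : ∀ {m₁ m₂} → m₁ < m₂ → m₂ ≤ t →
                    AllIn (HasColour x) 1 m₁ → AllIn (HasColour x) m₂ t → Within t D m₁ m₂
      wrap-within {m₁} {m₂} m₁<m₂ m₂≤t low high =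
        within (ℤ.- + (m₁ + Δ)) (+ 1) (subst (_≤ D) (sym (ℤₚ.∣-i∣≡∣i∣ (+ (m₁ + Δ)))) bounded)
               (trans (once-around (+ m₁) (+ Δ) (+ m₂))
                      (cong₂ (λ s T → + m₁ ℤ.+ ℤ.- s ℤ.+ + 1 ℤ.* T) (sym (ℤₚ.pos-+ m₁ Δ))
                             (trans (sym (ℤₚ.pos-+ Δ m₂)) (cong +_ (m∸n+n≡m m₂≤t)))))
        where
        Δ = t ∸ m₂
        κ′ : Fin m₁ ⊎ Fin (suc Δ) → ℕ
        κ′ (inj₁ j) = suc (toℕ j)
        κ′ (inj₂ j) = m₂ + toℕ j
        κ′-injective : Injective _≡_ _≡_ κ′
        κ′-injective {inj₁ j} {inj₁ j′} eq = cong inj₁ (Fin.toℕ-injective (suc-injective eq))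
        κ′-injective {inj₂ j} {inj₂ j′} eq = cong inj₂ (Fin.toℕ-injective (+-cancelˡ-≡ m₂ _ _ eq))
        κ′-injective {inj₁ j} {inj₂ j′} eq =
          contradiction (subst (_≤ m₁) eq (Fin.toℕ<n j))
                        (<⇒≱ (<-≤-trans m₁<m₂ (m≤m+n m₂ (toℕ j′))))
        κ′-injective {inj₂ j} {inj₁ j′} eq =
          contradiction (subst (_≤ m₁) (sym eq) (Fin.toℕ<n j′))
                        (<⇒≱ (<-≤-trans m₁<m₂ (m≤m+n m₂ (toℕ j))))
        κ′-coloured : ∀ a → ¬ ¬ HasColour x (κ′ a)
        κ′-coloured (inj₁ j) = low (suc (toℕ j)) (s≤s z≤n) (Fin.toℕ<n j)
        κ′-coloured (inj₂ j) = high (m₂ + toℕ j) (m≤m+n m₂ (toℕ j))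
          (≤-trans (+-monoʳ-≤ m₂ (≤-pred (Fin.toℕ<n j))) (≤-reflexive (m+[n∸m]≡n m₂≤t)))
        counted : m₁ + suc Δ ≤ length L
        counted = distinct-colours-≤-length (κ′ ∘ splitAt m₁)
          (λ {i} {j} eq → trans (sym (Fin.join-splitAt m₁ (suc Δ) i))
             (trans (cong (Fin.join m₁ (suc Δ)) (κ′-injective {splitAt m₁ i} {splitAt m₁ j} eq))
                    (Fin.join-splitAt m₁ (suc Δ) j)))
          (κ′-coloured ∘ splitAt m₁)
        bounded : m₁ + Δ ≤ D
        bounded = ≤-pred (≤-trans (≤-reflexive (sym (+-suc m₁ Δ))) (≤-trans counted short))
        once-around : ∀ A B C → C ≡ A ℤ.+ ℤ.- (A ℤ.+ B) ℤ.+ + 1 ℤ.* (B ℤ.+ C)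
        once-around = ℤ-Solver.solve-∀

      ordered-colours-within : ∀ {m₁ m₂} → HasColour x m₁ → HasColour x m₂ →
                               1 ≤ m₁ → m₁ ≤ m₂ → m₂ ≤ t → Within t D m₁ m₂
      ordered-colours-within has₁ has₂ 1≤m₁ m₁≤m₂ m₂≤t
        with cyclicInterval-arc (cyclic x) 1≤m₁ m₁≤m₂ m₂≤t has₁ has₂
      ... | inj₁ arc                = arc-within m₁≤m₂ arc
      ... | inj₂ (m₁<m₂ , low , high) = wrap-within m₁<m₂ m₂≤t low high

      colours-within : ∀ {y₁ y₂} → Adj x y₁ → Adj x y₂ → Within t D (c x y₁) (c x y₂)
      colours-within {y₁} {y₂} xy₁ xy₂ with ≤-total (c x y₁) (c x y₂)
      ... | inj₁ c₁≤c₂ = ordered-colours-within (y₁ , xy₁ , refl) (y₂ , xy₂ , refl)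
                           (proj₁ (range xy₁)) c₁≤c₂ (proj₂ (range xy₂))
      ... | inj₂ c₂≤c₁ = within-sym (ordered-colours-within (y₂ , xy₂ , refl) (y₁ , xy₁ , refl)
                           (proj₁ (range xy₂)) c₂≤c₁ (proj₂ (range xy₁)))

concatWhere : ∀ {A : Set} {m} → (Fin m → Bool) → (Fin m → List A) → List A
concatWhere {m = zero}  P g = []
concatWhere {m = suc m} P g = (if P Fin.zero then g Fin.zero else []) ++ concatWhere (P ∘ Fin.suc) (g ∘ Fin.suc)

∈-if⁺ : ∀ {A : Set} {b} {x : A} {xs} → T b → x ∈ xs → x ∈ (if b then xs else [])
∈-if⁺ {b = true} _ x∈xs = x∈xs

∈-concatWhere⁺ : ∀ {A : Set} {m} {P : Fin m → Bool} {g : Fin m → List A} {x} (i : Fin m) →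
                 T (P i) → x ∈ g i → x ∈ concatWhere P g
∈-concatWhere⁺ Fin.zero    Pi x∈ = ∈-++⁺ˡ (∈-if⁺ Pi x∈)
∈-concatWhere⁺ {P = P} {g} (Fin.suc i) Pi x∈ =
  ∈-++⁺ʳ (if P Fin.zero then g Fin.zero else []) (∈-concatWhere⁺ i Pi x∈)

length-concatWhere : ∀ {A : Set} {m} (P : Fin m → Bool) {g : Fin m → List A} {ℓ : Fin m → ℕ} →
                     (∀ i → length (g i) ≡ ℓ i) → length (concatWhere P g) ≡ sumWhere P ℓ
length-concatWhere {m = zero}  P lengths = refl
length-concatWhere {m = suc m} P {g} {ℓ} lengths =
  trans (length-++ (if P Fin.zero then g Fin.zero else []))
        (cong₂ _+_ head-length (length-concatWhere (P ∘ Fin.suc) (lengths ∘ Fin.suc)))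
  where
  head-length : length (if P Fin.zero then g Fin.zero else []) ≡ (if P Fin.zero then ℓ Fin.zero else 0)
  head-length with P Fin.zero
  ... | true  = lengths Fin.zero
  ... | false = refl

module _ {n : ℕ} (P : ProjectivePlane n) where
  open ProjectivePlane P

  lines-meet : ∀ l l′ → Σ (Fin (N n)) λ p → T (incident l p) × T (incident l′ p)
  lines-meet l l′ with l Fin.≟ l′
  ... | yes refl = let (p , l∋p) = count≡suc⇒nonempty (incident l) (line-size l) in p , l∋p , l∋p
  ... | no l≢l′  = let (p , l∋p , l′∋p , _) = two-lines l l′ l≢l′ in p , l∋p , l′∋p

  module _ (r : Fin (N n) → ℕ) {k : ℕ} (f : Fin k → ErdV P r) where
    open Graph (attachPendant (Erd P r) k f) using (V; Adj)

    -- Every pendant is listed at every vertex: an upper bound on neighbourhoods suffices.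
    pendants : List V
    pendants = List.tabulate inj₂

    lineNeighbours : Fin (N n) → List V
    lineNeighbours i = inj₁ u ∷ concatWhere (incident i) (λ q → [ inj₁ (pt q) ]) ++ pendants

    pointNeighbours : Fin (N n) → List V
    pointNeighbours p = concatWhere (λ i → incident i p) (λ i → List.tabulate (inj₁ ∘ vx i)) ++ pendants

    lineNeighbours-complete : ∀ {i j y} → Adj (inj₁ (vx i j)) y → y ∈ lineNeighbours i
    lineNeighbours-complete (old v-u)               = here refl
    lineNeighbours-complete (old (v-p {k = q} i∋q)) = there (∈-++⁺ˡ (∈-concatWhere⁺ q i∋q (here refl)))
    lineNeighbours-complete (pend {j = j} _)        = there (∈-++⁺ʳ _ (∈-tabulate⁺ j))

    pointNeighbours-complete : ∀ {p y} → Adj (inj₁ (pt p)) y → y ∈ pointNeighbours p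
    pointNeighbours-complete (old (p-v {i = i} {j} i∋p)) = ∈-++⁺ˡ (∈-concatWhere⁺ i i∋p (∈-tabulate⁺ j))
    pointNeighbours-complete (pend {j = j} _)            = ∈-++⁺ʳ _ (∈-tabulate⁺ j)

    length-lineNeighbours : ∀ i → length (lineNeighbours i) ≡ suc (suc n + k)
    length-lineNeighbours i = cong suc (trans (length-++ (concatWhere (incident i) (λ q → [ inj₁ (pt q) ])))
      (cong₂ _+_ (trans (length-concatWhere (incident i) (λ _ → refl)) (line-size i)) (length-tabulate inj₂)))

    length-pointNeighbours : ∀ p → length (pointNeighbours p) ≡ sumWhere (λ i → incident i p) r + k
    length-pointNeighbours p =
      trans (length-++ (concatWhere (λ i → incident i p) (λ i → List.tabulate (inj₁ ∘ vx i))))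
            (cong₂ _+_ (length-concatWhere (λ i → incident i p) (λ i → length-tabulate (inj₁ ∘ vx {P = P} {r} i)))
                       (length-tabulate inj₂))

module _ {n : ℕ} (P : ProjectivePlane n) (r : Fin (N n) → ℕ) (r-pos : ∀ i → 1 ≤ r i)
         {k : ℕ} (f : Fin k → ErdV P r) {t : ℕ} (col : CyclicIntervalColoring (attachPendant (Erd P r) k f) t)
         (top : ℕ) (point-weight≤top : ∀ p → sumWhere (λ i → ProjectivePlane.incident P i p) r ≤ top) where
  open ProjectivePlane P
  open CyclicIntervalColoring col using (c; symmetric; range; proper)

  H : Graph
  H = attachPendant (Erd P r) k f

  Dv Dp Dt : ℕ
  Dv = suc n + k
  Dp = top + k
  Dt = Dv + Dp + Dv

  line-colours-within : ∀ i j {y₁ y₂} → Graph.Adj H (inj₁ (vx i j)) y₁ → Graph.Adj H (inj₁ (vx i j)) y₂ →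
                        Within t Dv (c (inj₁ (vx i j)) y₁) (c (inj₁ (vx i j)) y₂)
  line-colours-within i j = colours-within H col (inj₁ (vx i j)) (lineNeighbours P r f i)
    (lineNeighbours-complete P r f) (≤-reflexive (length-lineNeighbours P r f i))

  point-colours-within : ∀ p {y₁ y₂} → Graph.Adj H (inj₁ (pt p)) y₁ → Graph.Adj H (inj₁ (pt p)) y₂ →
                         Within t Dp (c (inj₁ (pt p)) y₁) (c (inj₁ (pt p)) y₂)
  point-colours-within p = colours-within H col (inj₁ (pt p)) (pointNeighbours P r f p)
    (pointNeighbours-complete P r f)
    (≤-trans (≤-reflexive (length-pointNeighbours P r f p))
             (≤-trans (+-monoˡ-≤ k (point-weight≤top p)) (n≤1+n Dp)))

  u-colour : ∀ i → Fin (r i) → ℕ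
  u-colour i j = c (inj₁ u) (inj₁ (vx i j))

  -- Around the path u – vx i₀ j₀ – pt p – vx i j – u, where p is a common point of the two lines.
  u-colours-within : ∀ {i₀} (j₀ : Fin (r i₀)) i j → Within t Dt (u-colour i₀ j₀) (u-colour i j)
  u-colours-within {i₀} j₀ i j =
    subst₂ (Within t Dt) (symmetric (old v-u)) (symmetric (old v-u))
      (within-trans (within-trans (line-colours-within i₀ j₀ (old v-u) (old (v-p i₀∋p))) at-p)
                    (line-colours-within i j (old (v-p i∋p)) (old v-u)))
    where
    p : Fin (N n)
    p = proj₁ (lines-meet P i₀ i)
    i₀∋p : T (incident i₀ p)
    i₀∋p = proj₁ (proj₂ (lines-meet P i₀ i))
    i∋p : T (incident i p)
    i∋p = proj₂ (proj₂ (lines-meet P i₀ i))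
    at-p : Within t Dp (c (inj₁ (vx i₀ j₀)) (inj₁ (pt p))) (c (inj₁ (vx i j)) (inj₁ (pt p)))
    at-p = subst₂ (Within t Dp) (symmetric (old (p-v i₀∋p))) (symmetric (old (p-v i∋p)))
      (point-colours-within p (old (p-v i₀∋p)) (old (p-v i∋p)))

  -- Distinct edges at u get distinct colours, and a colour is fixed by its shift from a base edge.
  sum-r≤ : 0 < N n → sum r ≤ suc Dt + Dt
  sum-r≤ 0<N = Fin.injective⇒≤ {f = code} code-injective
    where
    i₀ : Fin (N n)
    i₀ = fromℕ< 0<N

    edge-colour : Fin (sum r) → ℕ
    edge-colour e = u-colour (proj₁ (toΣ r e)) (proj₂ (toΣ r e))

    offset : ∀ e → Within t Dt (u-colour i₀ (fromℕ< (r-pos i₀))) (edge-colour e)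
    offset e = u-colours-within (fromℕ< (r-pos i₀)) (proj₁ (toΣ r e)) (proj₂ (toΣ r e))

    code : Fin (sum r) → Fin (suc Dt + Dt)
    code e = shiftCode Dt (Within.shift (offset e)) (Within.bounded (offset e))

    vx-injective : ∀ {i i′ j j′} → _≡_ {A = Graph.V H} (inj₁ (vx i j)) (inj₁ (vx i′ j′)) →
                   _≡_ {A = Σ (Fin (N n)) (Fin ∘ r)} (i , j) (i′ , j′)
    vx-injective refl = refl

    code-injective : ∀ {e e′} → code e ≡ code e′ → e ≡ e′
    code-injective {e} {e′} same = toΣ-injective r (vx-injective (proper (old u-v) (old u-v) (sym colour≡)))
      where
      colour≡ : edge-colour e′ ≡ edge-colour e
      colour≡ = same-shift⇒≡ (offset e) (offset e′)
        (shiftCode-injective Dt (Within.bounded (offset e)) (Within.bounded (offset e′)) same)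
        (proj₁ (range (old u-v))) (proj₂ (range (old u-v))) (proj₁ (range (old u-v))) (proj₂ (range (old u-v)))

0<N : ∀ n → 0 < N n
0<N n = m≤n+m 1 (n * n + n)

n+1<N : ∀ {n} → 1 ≤ n → n + 1 < N n
n+1<N {n} 1≤n = +-monoˡ-≤ 1 (+-monoˡ-≤ n (*-mono-≤ 1≤n 1≤n))

erd-slack : ∀ {n k s} → 2 ≤ n → n + 1 ≤ s →
            suc ((suc n + k) + (s + k) + (suc n + k)) + ((suc n + k) + (s + k) + (suc n + k)) + 9
              ≤ s + (10 * k + 9 * s)
erd-slack {suc (suc a)} {k} (s≤s (s≤s z≤n)) n+1≤s with m≤n⇒∃[o]m+o≡n n+1≤s
... | b , refl = ≤-trans (m≤m+n _ (2 + 4 * a + 4 * k + 8 * b)) (≤-reflexive (expand a b k))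
  where
  expand : ∀ a b k → let s = suc (suc a) + 1 + b ; D = (suc (suc (suc a)) + k) + (s + k) + (suc (suc (suc a)) + k) in
           suc D + D + 9 + (2 + 4 * a + 4 * k + 8 * b) ≡ s + (10 * k + 9 * s)
  expand = ℕ-Solver.solve-∀

erd-arithmetic : ∀ {n k s T} → 2 ≤ n → n + 1 ≤ s →
                 s + T ≤ suc ((suc n + k) + (s + k) + (suc n + k)) + ((suc n + k) + (s + k) + (suc n + k)) →
                 T + 9 ≤ 10 * k + 9 * s
erd-arithmetic {n} {k} {s} {T} 2≤n n+1≤s bound = +-cancelˡ-≤ s _ _ (begin
  s + (T + 9)           ≡⟨ +-assoc s T 9 ⟨
  s + T + 9             ≤⟨ +-monoˡ-≤ 9 bound ⟩
  _                     ≤⟨ erd-slack 2≤n n+1≤s ⟩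
  s + (10 * k + 9 * s)  ∎)
  where open ≤-Reasoning

theorem13 : (n : ℕ) → 2 ≤ n → (P : ProjectivePlane n) →
    (r : Fin (N n) → ℕ) → (∀ i → 1 ≤ r i) →
    (∀ i j → toℕ i ≤ toℕ j → r j ≤ r i) →
    (k : ℕ) (f : Fin k → ErdV P r) →
    HasCyclicIntervalColoring (attachPendant (Erd P r) k f) →
    sumWhere (λ i → not (toℕ i <ᵇ n + 1)) r + 9
      ≤ 10 * k + 9 * sumWhere (λ i → toℕ i <ᵇ n + 1) r
theorem13 n 2≤n P r r-pos antitone k f (t , col) =
  erd-arithmetic 2≤n n+1≤top
    (≤-trans (≤-reflexive (sym (sum≡sumWhere+sumWhere-not initial r)))
             (sum-r≤ P r r-pos f col top point-weight≤top (0<N n)))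
  where
  initial : Fin (N n) → Bool
  initial i = toℕ i <ᵇ n + 1

  top : ℕ
  top = sumWhere initial r

  n+1<N′ : n + 1 < N n
  n+1<N′ = n+1<N (≤-trans (s≤s z≤n) 2≤n)

  point-weight≤top : ∀ p → sumWhere (λ i → ProjectivePlane.incident P i p) r ≤ top
  point-weight≤top p =
    sumWhere-≤-initial r antitone _ n+1<N′ (trans (ProjectivePlane.point-deg P p) (+-comm 1 n))

  n+1≤top : n + 1 ≤ top
  n+1≤top = subst (_≤ top) (trans (*-identityʳ (count initial)) (count-initial (n + 1) (<⇒≤ n+1<N′)))
    (count*bound≤sumWhere initial r 1 (λ i _ → r-pos i))
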